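{- For every $n\ge 1$, the average, over all rooted ordered trees $T$ with $n$ edges, of the tree edit distance between $T$ and the star with $n$ edges (the tree of height $1$ whose $n$ edges all join the root to a leaf) equals $n-1$. Equivalently, the average of $d(\sigma,12\cdots n)$ over all one-stack sortable permutations $\sigma$ of $\{1,\dots,n\}$ is $n-1$.
   Context: Rooted ordered trees have the children of each vertex ordered left to right; there are $C_n=\frac{1}{n+1}\binom{2n}{n}$ of them with $n$ edges. Tree edit operations (unit cost): deletion of an edge $(p(v),v)$ contracts it, merging $v$ into its parent $p(v)$, the children of $v$ replacing $v$ in order among the children of $p(v)$; insertion is the converse. The tree edit distance is the minimal number of such operations transforming one tree into the other. One-stack sortable permutations: the empty word is one; a permutation $\sigma$ of $\{1,\dots,n\}$, $n\ge1$, is one if $\sigma=I\,n\,J$ for some $0\le p\le n-1$, with $I$ a one-stack sortable permutation of $\{1,\dots,p\}$ and $J$ a word on $\{p+1,\dots,n-1\}$ that becomes one-stack sortable after subtracting $p$ from each letter. A factor of $\sigma$ is a word of consecutive letters; it is compact if its letters form an integer interval; a factor $f$ is complete if it is compact and there is no nonempty factor $g$ with $fg$ a factor of $\sigma$ that is compact and has the same largest letter as $f$. For a word $w$ and integer $a$, $\overline{w}^{a}$ adds $1$ to each letter $\ge a$. Deletion $(\sigma_k\to\Lambda)$: remove $\sigma_k$ and decrease by $1$ all letters greater than $\sigma_k$. Insertion: $(\Lambda\to\varnothing)$ maps the empty word to $(1)$; for $\sigma=ufv$ nonempty with $f$ a complete factor, $(\Lambda\to f)$ gives $\overline{u}^{a}af\overline{v}^{a}$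 and $(\Lambda\overset{r}{\to}f)$ gives $\overline{u}^{a}fa\overline{v}^{a}$, with $a=\max f+1$, and $(\Lambda\overset{l}{\to}f)$ gives $\overline{u}^{a}a\overline{f}^{a}\overline{v}^{a}$ with $a=\min f$. $d(\sigma_1,\sigma_2)$ is the minimal number of such deletions and insertions transforming $\sigma_1$ into $\sigma_2$; $12\cdots n$ is the identity permutation. -}

module Defs where

open import Data.Nat using (ℕ; zero; suc; _+_; _*_; _∸_; _≤_; _<_; _⊔_; _⊓_; _≤ᵇ_; _<ᵇ_; pred)
open import Data.List using (List; []; _∷_; _++_; map; replicate; length; upTo; foldr)
open import Data.Bool using (if_then_else_)
open import Data.Product using (Σ; ∃; _×_; _,_)
open import Data.Sum using (_⊎_)
open import Relation.Nullary using (¬_)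
open import Relation.Binary.PropositionalEquality using (_≡_; _≢_)
open import Data.List.Relation.Binary.Permutation.Propositional using (_↭_)

data Path {A : Set} (R : A → A → Set) : ℕ → A → A → Set where
  done : ∀ {x} → Path R 0 x x
  step : ∀ {k x y z} → R x y → Path R k y z → Path R (suc k) x z

IsDist : {A : Set} (R : A → A → Set) → A → A → ℕ → Set
IsDist R x y k = Path R k x y × (∀ j → j < k → ¬ Path R j x y)

data Tree : Set where
  node : List Tree → Tree

mutual
  edges : Tree → ℕ
  edges (node ts) = edgesL ts

  edgesL : List Tree → ℕ
  edgesL [] = 0
  edgesL (t ∷ ts) = suc (edges t + edgesL ts)

star : ℕ → Tree
star n = node (replicate n (node []))

-- deletion of an edge (p(v),v): v is contracted into its parent, its
-- children replacing v in order among the children of p(v)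
data TDel : Tree → Tree → Set where
  here  : ∀ ls cs rs → TDel (node (ls ++ node cs ∷ rs)) (node (ls ++ cs ++ rs))
  there : ∀ ls {t t'} rs → TDel t t' → TDel (node (ls ++ t ∷ rs)) (node (ls ++ t' ∷ rs))

TStep : Tree → Tree → Set
TStep s t = TDel s t ⊎ TDel t s

-- σ = I n J with I OSS on {1..p}, J (shifted by p) OSS, n = p + |J| + 1
data OSS : List ℕ → Set where
  empty : OSS []
  split : ∀ {I J} → OSS I → OSS J →
          OSS (I ++ suc (length I + length J) ∷ map (length I +_) J)

identity : ℕ → List ℕ
identity n = map suc (upTo n)

range : ℕ → ℕ → List ℕ
range a k = map (a +_) (upTo k)

Compact : List ℕ → Set
Compact f = (f ≢ []) × ∃ λ a → f ↭ range a (length f)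

maxL : List ℕ → ℕ
maxL [] = 0
maxL (x ∷ xs) = foldr _⊔_ x xs

minL : List ℕ → ℕ
minL [] = 0
minL (x ∷ xs) = foldr _⊓_ x xs

-- f is a complete factor at the occurrence σ = u f v
Complete : List ℕ → List ℕ → List ℕ → Set
Complete u f v = Compact f ×
  (∀ g v' → v ≡ g ++ v' → g ≢ [] → Compact (f ++ g) → maxL (f ++ g) ≢ maxL f)

bump : ℕ → List ℕ → List ℕ
bump a = map (λ x → if a ≤ᵇ x then suc x else x)

unbump : ℕ → List ℕ → List ℕ
unbump x = map (λ y → if x <ᵇ y then pred y else y)

data PDel : List ℕ → List ℕ → Set where
  del : ∀ u x v → PDel (u ++ x ∷ v) (unbump x u ++ unbump x v)

data PIns : List ℕ → List ℕ → Set where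
  insE : PIns [] (1 ∷ [])
  insA : ∀ u f v → Complete u f v →
         PIns (u ++ f ++ v) (bump (suc (maxL f)) u ++ suc (maxL f) ∷ f ++ bump (suc (maxL f)) v)
  insR : ∀ u f v → Complete u f v →
         PIns (u ++ f ++ v) (bump (suc (maxL f)) u ++ f ++ suc (maxL f) ∷ bump (suc (maxL f)) v)
  insL : ∀ u f v → Complete u f v →
         PIns (u ++ f ++ v) (bump (minL f) u ++ minL f ∷ bump (minL f) f ++ bump (minL f) v)

PStep : List ℕ → List ℕ → Set
PStep σ τ = PDel σ τ ⊎ PIns σ τ

-- Both distances are twice a statistic s: the number of internal vertices other than the root
-- of a tree, and the number of descents of a permutation. An edit changes the size by one; a
-- deletion lowers s by at most one and an insertion never lowers it, so 2s − size drops by at most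
-- one per step. The star and 12⋯n have s = 0 and the same size as their partners, hence every
-- edit path has length at least 2s. Contracting the inner vertices and then adding leaves, resp.
-- deleting the top letter of each descent and then inserting new smallest letters, attains 2s.
-- Through the rotation correspondence, resp. the decomposition σ = I n J, both families are in
-- bijection with binary trees with n nodes, s becoming the number of left, resp. right, edges.
-- These total n − 1 and are exchanged by mirroring, so the average of 2s is n − 1.

module Submission where

open import Defs
open import Data.Nat using (ℕ; zero; suc; pred; _+_; _*_; _∸_; _⊔_; _⊓_; _≤_; _<_; _≤ᵇ_; _<ᵇ_; z≤n; s≤s; >-nonZero)
open import Data.Nat.Properties
open import Data.Nat.ListAction using (sum)
open import Data.Nat.ListAction.Properties using (sum-↭)
open import Data.List using (List; []; _∷_; _++_; map; length; replicate; foldr; applyUpTo)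
open import Data.List.Properties
  using ( map-∘; map-cong; map-id; map-++; map-injective; map-applyUpTo; length-map; length-++
        ; ∷-injective; ++-conicalˡ; ++-conicalʳ; ++-assoc; ++-identityʳ)
open import Data.List.Relation.Unary.All as All using (All; []; _∷_)
open import Data.List.Relation.Unary.Unique.Propositional using (Unique)
open import Data.List.Relation.Unary.AllPairs using ([]; _∷_)
import Data.List.Relation.Unary.Unique.Propositional.Properties as Unique
import Data.List.Relation.Unary.All.Properties as AllP
import Data.List.Relation.Unary.AllPairs.Properties as APP
open import Data.List.Membership.Propositional using (_∈_)
open import Data.List.Membership.Propositional.Properties using (∈-map⁺; ∈-map⁻)
open import Data.List.Membership.Propositional.Properties.WithK using (unique∧set⇒bag)
open import Data.List.Relation.Binary.BagAndSetEquality using (∼bag⇒↭)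
open import Data.List.Relation.Binary.Permutation.Propositional using (_↭_; ↭-reflexive)
import Data.List.Relation.Binary.Permutation.Propositional.Properties as Perm
open import Data.Product using (Σ; ∃; _×_; _,_; proj₁; proj₂; map₂)
open import Data.Sum as Sum using (inj₁; inj₂)
open import Data.Unit using (⊤; tt)
open import Function using (_∘_; id)
open import Function.Bundles using (mk⇔)
open import Function.Definitions using (Injective)
open import Relation.Binary.PropositionalEquality
open import Relation.Binary.Definitions using (tri<; tri≈; tri>)
open import Relation.Nullary using (contradiction; yes; no)
open import Data.Bool using (true; false; if_then_else_)
open import Data.Nat.Tactic.RingSolver using (solve-∀)
open import Algebra.Properties.CommutativeSemigroup +-commutativeSemigroup
  using () renaming (interchange to +-interchange)

private
  variable
    A B : Set
    R : A → A → Set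
    k m : ℕ
    x y z : A

replicate-+ : ∀ m n {x : A} → replicate (m + n) x ≡ replicate m x ++ replicate n x
replicate-+ zero    n = refl
replicate-+ (suc m) n = cong (_ ∷_) (replicate-+ m n)

length-++-∷ : ∀ (xs : List A) {x ys} → length (xs ++ x ∷ ys) ≡ suc (length (xs ++ ys))
length-++-∷ []       = refl
length-++-∷ (_ ∷ xs) = cong suc (length-++-∷ xs)

++-∷-≢-[] : ∀ (xs : List A) {y ys} → xs ++ y ∷ ys ≢ []
++-∷-≢-[] xs eq with () ← ++-conicalʳ xs _ eq

map-++³ : ∀ (g : A → B) u f v → map g (u ++ f ++ v) ≡ map g u ++ map g f ++ map g v
map-++³ g u f v = trans (map-++ g u (f ++ v)) (cong (map g u ++_) (map-++ g f v))

split-at-max : ∀ (xs xs′ : List ℕ) {m m′ ys ys′} → xs ++ m ∷ ys ≡ xs′ ++ m′ ∷ ys′ →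
               All (_< m′) xs → All (_< m) xs′ → xs ≡ xs′ × ys ≡ ys′
split-at-max []       []         refl _           _           = refl , refl
split-at-max []       (_ ∷ _)    refl _           (m<m ∷ _)   = contradiction m<m (<-irrefl refl)
split-at-max (_ ∷ _)  []         refl (m<m ∷ _)   _           = contradiction m<m (<-irrefl refl)
split-at-max (x ∷ xs) (x′ ∷ xs′) eq   (_ ∷ xs<m′) (_ ∷ xs′<m)
  with refl , eq′ ← ∷-injective eq
  with xs≡ , ys≡ ← split-at-max xs xs′ eq′ xs<m′ xs′<m = cong (x ∷_) xs≡ , ys≡

All-extract : {P : A → Set} → ∀ xs {x ys} → All P (xs ++ x ∷ ys) → P x × All P (xs ++ ys)
All-extract []       (Px ∷ Pys) = Px , Pys
All-extract (_ ∷ xs) (Pa ∷ Pw)  = map₂ (Pa ∷_) (All-extract xs Pw)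

All-insert : {P : A → Set} → ∀ xs {x ys} → P x → All P (xs ++ ys) → All P (xs ++ x ∷ ys)
All-insert []       Px Pw        = Px ∷ Pw
All-insert (_ ∷ xs) Px (Pa ∷ Pw) = Pa ∷ All-insert xs Px Pw

Unique-extract : ∀ (xs : List A) {x ys} → Unique (xs ++ x ∷ ys) → All (x ≢_) (xs ++ ys) × Unique (xs ++ ys)
Unique-extract []       (x∉ ∷ !w) = x∉ , !w
Unique-extract (_ ∷ xs) (a∉ ∷ !w)
  with a≢x , a∉′ ← All-extract xs a∉ | x∉ , !w′ ← Unique-extract xs !w = (≢-sym a≢x ∷ x∉) , (a∉′ ∷ !w′)

Unique-insert : ∀ (xs : List A) {x ys} → All (x ≢_) (xs ++ ys) → Unique (xs ++ ys) → Unique (xs ++ x ∷ ys)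
Unique-insert []       x∉         !w        = x∉ ∷ !w
Unique-insert (_ ∷ xs) (x≢a ∷ x∉) (a∉ ∷ !w) = All-insert xs (≢-sym x≢a) a∉ ∷ Unique-insert xs x∉ !w

Path-cast : ∀ {k′ x′ y′} → k ≡ k′ → x ≡ x′ → y ≡ y′ → Path R k x y → Path R k′ x′ y′
Path-cast refl refl refl p = p

_++ᴾ_ : Path R k x y → Path R m y z → Path R (k + m) x z
done       ++ᴾ q = q
step r p   ++ᴾ q = step r (p ++ᴾ q)

Path-map : {S : B → B → Set} (f : A → B) → (∀ {x y} → R x y → S (f x) (f y)) →
           Path R k x y → Path S k (f x) (f y)
Path-map f g done       = done
Path-map f g (step r p) = step (g r) (Path-map f g p)

isDist : Path R k x y → (∀ {j} → Path R j x y → k ≤ j) → IsDist R x y k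
isDist p minimal = p , λ j j<k q → <⇒≱ j<k (minimal q)

data BoundedStep {A : Set} (size stat : A → ℕ) (x y : A) : Set where
  deletion  : size x ≡ suc (size y) → stat x ≤ suc (stat y) → BoundedStep size stat x y
  insertion : size y ≡ suc (size x) → stat x ≤ stat y → BoundedStep size stat x y

module LowerBound {R : A → A → Set} (Inv : A → Set) (size stat : A → ℕ)
  (bounded : ∀ {x y} → Inv x → R x y → Inv y × BoundedStep size stat x y) where

  -- 2·stat − size drops by at most one per step, stated without truncated subtraction.
  potential-step : BoundedStep size stat x y → 2 * stat x + size y ≤ suc (2 * stat y + size x)
  potential-step {x = x} {y} (deletion size≡ stat≤) = begin
    2 * stat x + size y              ≤⟨ +-monoˡ-≤ (size y) (*-monoʳ-≤ 2 stat≤) ⟩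
    2 * suc (stat y) + size y        ≡⟨ shuffle (stat y) (size y) ⟩
    suc (2 * stat y + suc (size y))  ≡⟨ cong (λ s → suc (2 * stat y + s)) size≡ ⟨
    suc (2 * stat y + size x)        ∎
    where
    open ≤-Reasoning
    shuffle : ∀ a b → 2 * suc a + b ≡ suc (2 * a + suc b)
    shuffle = solve-∀
  potential-step {x = x} {y} (insertion size≡ stat≤) = begin
    2 * stat x + size y              ≤⟨ +-monoˡ-≤ (size y) (*-monoʳ-≤ 2 stat≤) ⟩
    2 * stat y + size y              ≡⟨ cong (2 * stat y +_) size≡ ⟩
    2 * stat y + suc (size x)        ≡⟨ +-suc (2 * stat y) (size x) ⟩
    suc (2 * stat y + size x)        ∎
    where open ≤-Reasoning

  potential-path : Path R k x y → Inv x → 2 * stat x + size y ≤ k + 2 * stat y + size x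
  potential-path done _ = ≤-refl
  potential-path {k = suc k} {x} {z} (step {y = y} r p) inv-x
    with inv-y , bstep ← bounded inv-x r =
    +-cancelʳ-≤ (2 * stat y + size y) _ _ (subst₂ _≤_
      (shuffleˡ (2 * stat x) (size y) (2 * stat y) (size z))
      (shuffleʳ (2 * stat y) (size x) k (2 * stat z) (size y))
      (+-mono-≤ (potential-step bstep) (potential-path p inv-y)))
    where
    shuffleˡ : ∀ a b c d → a + b + (c + d) ≡ a + d + (c + b)
    shuffleˡ = solve-∀
    shuffleʳ : ∀ a b k c d → suc (a + b) + (k + c + d) ≡ suc k + c + b + (a + d)
    shuffleʳ = solve-∀

  twice-stat≤length : Path R k x y → Inv x → stat y ≡ 0 → size y ≡ size x → 2 * stat x ≤ k
  twice-stat≤length {k = k} {x} {y} p inv-x stat-y size-y =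
    +-cancelʳ-≤ (size x) (2 * stat x) k
      (subst₂ _≤_ (cong (2 * stat x +_) size-y) eq (potential-path p inv-x))
    where
    eq : k + 2 * stat y + size x ≡ k + size x
    eq rewrite stat-y | +-identityʳ k = refl

IsEnumeration : (A → Set) → List A → Set
IsEnumeration P L = Unique L × All P L × (∀ x → P x → x ∈ L)

enumerations-↭ : {P : A → Set} {xs ys : List A} → IsEnumeration P xs → IsEnumeration P ys → xs ↭ ys
enumerations-↭ (!xs , Pxs , all-xs) (!ys , Pys , all-ys) = ∼bag⇒↭ (unique∧set⇒bag !xs !ys
  (mk⇔ (λ x∈xs → all-ys _ (All.lookup Pxs x∈xs)) (λ x∈ys → all-xs _ (All.lookup Pys x∈ys))))

sum-map-+ : (f g : A → ℕ) (L : List A) → sum (map (λ x → f x + g x) L) ≡ sum (map f L) + sum (map g L)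
sum-map-+ f g []      = refl
sum-map-+ f g (x ∷ L) = trans (cong (f x + g x +_) (sum-map-+ f g L)) (+-interchange (f x) (g x) _ _)

sum-map-const : {P : A → Set} (f : A → ℕ) {c : ℕ} → (∀ {x} → P x → f x ≡ c) →
                ∀ {L} → All P L → sum (map f L) ≡ c * length L
sum-map-const f {c} f≡c []                        = sym (*-zeroʳ c)
sum-map-const f {c} f≡c (_∷_ {x} {L} Px PL) = begin
  f x + sum (map f L) ≡⟨ cong₂ _+_ (f≡c Px) (sum-map-const f f≡c PL) ⟩
  c + c * length L    ≡⟨ *-suc c (length L) ⟨
  c * suc (length L)  ∎
  where open ≡-Reasoning

module _ {P : A → Set} (φ : A → A) (φ-P : ∀ {x} → P x → P (φ x)) (φ-involutive : ∀ x → φ (φ x) ≡ x) where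

  map-involution-↭ : ∀ {L} → IsEnumeration P L → map φ L ↭ L
  map-involution-↭ {L} enum@(!L , PL , all-L) =
    enumerations-↭ (!φL , AllP.map⁺ (All.map φ-P PL) , all-φL) enum
    where
    !φL : Unique (map φ L)
    !φL = Unique.map⁺ (λ {x} {y} eq → trans (sym (φ-involutive x)) (trans (cong φ eq) (φ-involutive y))) !L
    all-φL : ∀ x → P x → x ∈ map φ L
    all-φL x Px = subst (_∈ map φ L) (φ-involutive x) (∈-map⁺ φ (all-L (φ x) (φ-P Px)))

  sum-twice-by-involution : (f : A → ℕ) {c : ℕ} → (∀ {x} → P x → f x + f (φ x) ≡ c) →
                            ∀ {L} → IsEnumeration P L → sum (map (λ x → 2 * f x) L) ≡ c * length L
  sum-twice-by-involution f {c} pair {L} enum@(_ , PL , _) = begin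
    sum (map (λ x → 2 * f x) L)                 ≡⟨ cong sum (map-cong (λ x → cong (f x +_) (+-identityʳ (f x))) L) ⟩
    sum (map (λ x → f x + f x) L)               ≡⟨ sum-map-+ f f L ⟩
    sum (map f L) + sum (map f L)               ≡⟨ cong (sum (map f L) +_) sum-f∘φ ⟨
    sum (map f L) + sum (map (f ∘ φ) L)         ≡⟨ sum-map-+ f (f ∘ φ) L ⟨
    sum (map (λ x → f x + f (φ x)) L)           ≡⟨ sum-map-const _ pair PL ⟩
    c * length L                                ∎
    where
    open ≡-Reasoning
    sum-f∘φ : sum (map (f ∘ φ) L) ≡ sum (map f L)
    sum-f∘φ = trans (cong sum (map-∘ L)) (sum-↭ (Perm.map⁺ f (map-involution-↭ enum)))

module _ {P : A → Set} {Q : B → Set} (g : B → A) (g-injective : Injective _≡_ _≡_ g)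
         (g-Q : ∀ {b} → Q b → P (g b)) (g-onto : ∀ {a} → P a → ∃ λ b → Q b × g b ≡ a) where

  preimages : ∀ {L} → All P L → ∃ λ Bs → All Q Bs × map g Bs ≡ L
  preimages [] = [] , [] , refl
  preimages (Pa ∷ PL) with b , Qb , refl ← g-onto Pa | Bs , QBs , refl ← preimages PL =
    b ∷ Bs , Qb ∷ QBs , refl

  pullback-enumeration : ∀ {L} → IsEnumeration P L → ∃ λ Bs → IsEnumeration Q Bs × map g Bs ≡ L
  pullback-enumeration (!L , PL , all-L) with Bs , QBs , refl ← preimages PL =
    Bs , (Unique.map⁻ !L , QBs , all-Bs) , refl
    where
    all-Bs : ∀ b → Q b → b ∈ Bs
    all-Bs b Qb with b′ , b′∈Bs , gb≡gb′ ← ∈-map⁻ g (all-L (g b) (g-Q Qb)) =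
      subst (_∈ Bs) (sym (g-injective gb≡gb′)) b′∈Bs

-- Binary trees

data Bin : Set where
  tip : Bin
  bin : Bin → Bin → Bin

size : Bin → ℕ
size tip       = 0
size (bin l r) = suc (size l + size r)

isBin : Bin → ℕ
isBin tip       = 0
isBin (bin _ _) = 1

leftEdges : Bin → ℕ
leftEdges tip       = 0
leftEdges (bin l r) = isBin l + leftEdges l + leftEdges r

rightEdges : Bin → ℕ
rightEdges tip       = 0
rightEdges (bin l r) = isBin r + rightEdges r + rightEdges l

mirror : Bin → Bin
mirror tip       = tip
mirror (bin l r) = bin (mirror r) (mirror l)

mirror-involutive : ∀ b → mirror (mirror b) ≡ b
mirror-involutive tip       = refl
mirror-involutive (bin l r) = cong₂ bin (mirror-involutive l) (mirror-involutive r)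

size-mirror : ∀ b → size (mirror b) ≡ size b
size-mirror tip       = refl
size-mirror (bin l r) = cong suc (trans (cong₂ _+_ (size-mirror r) (size-mirror l)) (+-comm (size r) (size l)))

isBin-mirror : ∀ b → isBin (mirror b) ≡ isBin b
isBin-mirror tip       = refl
isBin-mirror (bin _ _) = refl

leftEdges-mirror : ∀ b → leftEdges (mirror b) ≡ rightEdges b
leftEdges-mirror tip       = refl
leftEdges-mirror (bin l r) = cong₂ _+_ (cong₂ _+_ (isBin-mirror r) (leftEdges-mirror r)) (leftEdges-mirror l)

rightEdges-mirror : ∀ b → rightEdges (mirror b) ≡ leftEdges b
rightEdges-mirror tip       = refl
rightEdges-mirror (bin l r) = cong₂ _+_ (cong₂ _+_ (isBin-mirror l) (rightEdges-mirror l)) (rightEdges-mirror r)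

isBin+size∸1 : ∀ b → isBin b + (size b ∸ 1) ≡ size b
isBin+size∸1 tip       = refl
isBin+size∸1 (bin _ _) = refl

-- Every node except the root is the left or the right child of its parent.
leftEdges+rightEdges : ∀ b → leftEdges b + rightEdges b ≡ size b ∸ 1
leftEdges+rightEdges tip       = refl
leftEdges+rightEdges (bin l r) = begin
  isBin l + leftEdges l + leftEdges r + (isBin r + rightEdges r + rightEdges l)
    ≡⟨ regroup (isBin l) (leftEdges l) (leftEdges r) (isBin r) (rightEdges r) (rightEdges l) ⟩
  isBin l + (leftEdges l + rightEdges l) + (isBin r + (leftEdges r + rightEdges r))
    ≡⟨ cong₂ (λ x y → isBin l + x + (isBin r + y)) (leftEdges+rightEdges l) (leftEdges+rightEdges r) ⟩
  isBin l + (size l ∸ 1) + (isBin r + (size r ∸ 1))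
    ≡⟨ cong₂ _+_ (isBin+size∸1 l) (isBin+size∸1 r) ⟩
  size l + size r ∎
  where
  open ≡-Reasoning
  regroup : ∀ a b c d e f → a + b + c + (d + e + f) ≡ a + (b + f) + (d + (c + e))
  regroup = solve-∀

module _ {P : A → Set} {n : ℕ} (g : Bin → A) (g-injective : Injective _≡_ _≡_ g)
         (g-size : ∀ {b} → size b ≡ n → P (g b)) (g-onto : ∀ {a} → P a → ∃ λ b → size b ≡ n × g b ≡ a) where

  sum-via-bins : (f : A → ℕ) (h : Bin → ℕ) → (∀ b → f (g b) ≡ 2 * h b) →
                 (∀ b → h b + h (mirror b) ≡ size b ∸ 1) →
                 ∀ {L} → IsEnumeration P L → sum (map f L) ≡ (n ∸ 1) * length L
  sum-via-bins f h f∘g≡2h h-pair enum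
    with Bs , enum-Bs , refl ← pullback-enumeration g g-injective g-size g-onto enum = begin
    sum (map f (map g Bs))            ≡⟨ cong sum (map-∘ Bs) ⟨
    sum (map (f ∘ g) Bs)              ≡⟨ cong sum (map-cong f∘g≡2h Bs) ⟩
    sum (map (λ b → 2 * h b) Bs)
      ≡⟨ sum-twice-by-involution mirror mirror-size mirror-involutive h h-pair′ enum-Bs ⟩
    (n ∸ 1) * length Bs               ≡⟨ cong ((n ∸ 1) *_) (length-map g Bs) ⟨
    (n ∸ 1) * length (map g Bs)       ∎
    where
    open ≡-Reasoning
    mirror-size : ∀ {b} → size b ≡ n → size (mirror b) ≡ n
    mirror-size {b} = trans (size-mirror b)
    h-pair′ : ∀ {b} → size b ≡ n → h b + h (mirror b) ≡ n ∸ 1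
    h-pair′ {b} refl = h-pair b

-- Ordered trees

leaf : Tree
leaf = node []

children : Tree → List Tree
children (node ts) = ts

mutual
  internal : Tree → ℕ
  internal (node [])       = 0
  internal (node (t ∷ ts)) = suc (internalL (t ∷ ts))

  internalL : List Tree → ℕ
  internalL []       = 0
  internalL (t ∷ ts) = internal t + internalL ts

mutual
  leaves : Tree → ℕ
  leaves (node [])       = 1
  leaves (node (t ∷ ts)) = leavesL (t ∷ ts)

  leavesL : List Tree → ℕ
  leavesL []       = 0
  leavesL (t ∷ ts) = leaves t + leavesL ts

treeDist : Tree → ℕ
treeDist T = 2 * internalL (children T)

internalL-++ : ∀ xs ys → internalL (xs ++ ys) ≡ internalL xs + internalL ys
internalL-++ []       ys = refl
internalL-++ (x ∷ xs) ys = trans (cong (internal x +_) (internalL-++ xs ys)) (sym (+-assoc (internal x) _ _))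

edgesL-++ : ∀ xs ys → edgesL (xs ++ ys) ≡ edgesL xs + edgesL ys
edgesL-++ []       ys = refl
edgesL-++ (x ∷ xs) ys = cong suc (trans (cong (edges x +_) (edgesL-++ xs ys)) (sym (+-assoc (edges x) _ _)))

mutual
  suc-edges≡leaves+internal : ∀ t → suc (edges t) ≡ leaves t + internal t
  suc-edges≡leaves+internal (node [])       = refl
  suc-edges≡leaves+internal (node (t ∷ ts)) =
    trans (cong suc (edgesL≡leavesL+internalL (t ∷ ts))) (sym (+-suc (leavesL (t ∷ ts)) _))

  edgesL≡leavesL+internalL : ∀ ts → edgesL ts ≡ leavesL ts + internalL ts
  edgesL≡leavesL+internalL []       = refl
  edgesL≡leavesL+internalL (t ∷ ts) =
    trans (cong₂ _+_ (suc-edges≡leaves+internal t) (edgesL≡leavesL+internalL ts))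
          (+-interchange (leaves t) (internal t) (leavesL ts) (internalL ts))

TDel-edges : ∀ {s t} → TDel s t → edges s ≡ suc (edges t)
TDel-edges (here ls cs rs) = begin
  edgesL (ls ++ node cs ∷ rs)                ≡⟨ edgesL-++ ls _ ⟩
  edgesL ls + suc (edgesL cs + edgesL rs)    ≡⟨ +-suc (edgesL ls) _ ⟩
  suc (edgesL ls + (edgesL cs + edgesL rs))  ≡⟨ cong (λ e → suc (edgesL ls + e)) (edgesL-++ cs rs) ⟨
  suc (edgesL ls + edgesL (cs ++ rs))        ≡⟨ cong suc (edgesL-++ ls _) ⟨
  suc (edgesL (ls ++ cs ++ rs))              ∎
  where open ≡-Reasoning
TDel-edges (there ls {t} {t′} rs d) = begin
  edgesL (ls ++ t ∷ rs)                  ≡⟨ edgesL-++ ls _ ⟩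
  edgesL ls + edgesL (t ∷ rs)            ≡⟨ cong (λ e → edgesL ls + suc (e + edgesL rs)) (TDel-edges d) ⟩
  edgesL ls + suc (edgesL (t′ ∷ rs))     ≡⟨ +-suc (edgesL ls) _ ⟩
  suc (edgesL ls + edgesL (t′ ∷ rs))     ≡⟨ cong suc (edgesL-++ ls _) ⟨
  suc (edgesL (ls ++ t′ ∷ rs))           ∎
  where open ≡-Reasoning

internal-has-child : ∀ ls t rs → internal (node (ls ++ t ∷ rs)) ≡ suc (internalL (ls ++ t ∷ rs))
internal-has-child []      t rs = refl
internal-has-child (_ ∷ _) t rs = refl

internal-TDel-source : ∀ {s t} → TDel s t → internal s ≡ suc (internalL (children s))
internal-TDel-source (here ls cs rs)  = internal-has-child ls (node cs) rs
internal-TDel-source (there ls {t} rs _) = internal-has-child ls t rs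

TDel-leaf : ∀ {s t} → TDel s t → children t ≡ [] → internalL (children s) ≡ 0
TDel-leaf (here ls cs rs) ls++cs++rs≡[]
  with refl ← ++-conicalˡ ls _ ls++cs++rs≡[]
     | refl ← ++-conicalˡ cs rs (++-conicalʳ ls _ ls++cs++rs≡[])
     | refl ← ++-conicalʳ cs rs (++-conicalʳ ls _ ls++cs++rs≡[]) = refl
TDel-leaf (there ls rs _) ls++t′∷rs≡[] with () ← ++-conicalʳ ls _ ls++t′∷rs≡[]

mutual
  internalL-TDel : ∀ {s t} → TDel s t →
    internalL (children t) ≤ internalL (children s) × internalL (children s) ≤ suc (internalL (children t))
  internalL-TDel (here ls [] rs) rewrite internalL-++ ls (leaf ∷ rs) | internalL-++ ls rs = ≤-refl , n≤1+n _
  internalL-TDel (here ls cs@(_ ∷ _) rs)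
    rewrite internalL-++ ls (node cs ∷ rs) | internalL-++ ls (cs ++ rs) | internalL-++ cs rs
    = ≤-trans (n≤1+n _) (≤-reflexive (sym pull-suc)) , ≤-reflexive pull-suc
    where
    pull-suc : internalL ls + suc (internalL cs + internalL rs) ≡ suc (internalL ls + (internalL cs + internalL rs))
    pull-suc = +-suc (internalL ls) _
  internalL-TDel (there ls {t} {t′} rs d) rewrite internalL-++ ls (t ∷ rs) | internalL-++ ls (t′ ∷ rs)
    with lower , upper ← internal-TDel d =
    +-monoʳ-≤ (internalL ls) (+-monoˡ-≤ (internalL rs) lower) ,
    ≤-trans (+-monoʳ-≤ (internalL ls) (+-monoˡ-≤ (internalL rs) upper)) (≤-reflexive (+-suc (internalL ls) _))

  internal-TDel : ∀ {t t′} → TDel t t′ → internal t′ ≤ internal t × internal t ≤ suc (internal t′)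
  internal-TDel {t′ = node []} d rewrite internal-TDel-source d | TDel-leaf d refl = z≤n , ≤-refl
  internal-TDel {t′ = node (_ ∷ _)} d with lower , upper ← internalL-TDel d rewrite internal-TDel-source d =
    s≤s lower , s≤s upper

TStep-bounded : ∀ {s t} → TStep s t → BoundedStep edges (internalL ∘ children) s t
TStep-bounded (inj₁ d) = deletion (TDel-edges d) (proj₂ (internalL-TDel d))
TStep-bounded (inj₂ d) = insertion (TDel-edges d) (proj₁ (internalL-TDel d))

internalL-leaves : ∀ m → internalL (replicate m leaf) ≡ 0
internalL-leaves zero    = refl
internalL-leaves (suc m) = internalL-leaves m

edges-star : ∀ m → edges (star m) ≡ m
edges-star zero    = refl
edges-star (suc m) = cong suc (edges-star m)

treeDist-lower : ∀ {T n k} → edges T ≡ n → Path TStep k T (star n) → treeDist T ≤ k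
treeDist-lower {n = n} refl p =
  twice-stat≤length p tt (internalL-leaves n) (edges-star n)
  where open LowerBound (λ _ → ⊤) edges (internalL ∘ children) (λ _ r → tt , TStep-bounded r)

Path-inside : ∀ ls rs {k t t′} → Path TStep k t t′ → Path TStep k (node (ls ++ t ∷ rs)) (node (ls ++ t′ ∷ rs))
Path-inside ls rs = Path-map (λ t → node (ls ++ t ∷ rs)) (Sum.map (there ls rs) (there ls rs))

strip-[] : ∀ {k xs ys} → Path TStep k (node (xs ++ [])) (node (ys ++ [])) → Path TStep k (node xs) (node ys)
strip-[] = Path-cast refl (cong node (++-identityʳ _)) (cong node (++-identityʳ _))

flatten : ∀ ls ts rs →
  Path TStep (internalL ts) (node (ls ++ ts ++ rs)) (node (ls ++ replicate (leavesL ts) leaf ++ rs))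
flatten ls []                    rs = done
flatten ls (node [] ∷ ts)        rs =
  Path-cast refl (cong node (++-assoc ls _ _)) (cong node (++-assoc ls _ _)) (flatten (ls ++ leaf ∷ []) ts rs)
flatten ls (node (c ∷ cs) ∷ ts) rs =
  Path-cast (+-suc (internalL (c ∷ cs)) (internalL ts)) refl (cong node end≡)
    (Path-inside ls (ts ++ rs) (strip-[] (flatten [] (c ∷ cs) []))
      ++ᴾ step (inj₁ (here ls cs′ (ts ++ rs)))
               (Path-cast refl (cong node (++-assoc ls cs′ _)) refl (flatten (ls ++ cs′) ts rs)))
  where
  cs′ = replicate (leavesL (c ∷ cs)) leaf
  rest = replicate (leavesL ts) leaf
  end≡ : (ls ++ cs′) ++ rest ++ rs ≡ ls ++ replicate (leavesL (c ∷ cs) + leavesL ts) leaf ++ rs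
  end≡ = begin
    (ls ++ cs′) ++ rest ++ rs                                   ≡⟨ ++-assoc ls cs′ _ ⟩
    ls ++ cs′ ++ rest ++ rs                                     ≡⟨ cong (ls ++_) (++-assoc cs′ rest rs) ⟨
    ls ++ (cs′ ++ rest) ++ rs                                   ≡⟨ cong (λ xs → ls ++ xs ++ rs) (replicate-+ (leavesL (c ∷ cs)) _) ⟨
    ls ++ replicate (leavesL (c ∷ cs) + leavesL ts) leaf ++ rs  ∎
    where open ≡-Reasoning

grow-star : ∀ j m → Path TStep j (star m) (star (j + m))
grow-star zero    m = done
grow-star (suc j) m =
  step (inj₂ (here [] [] (replicate m leaf))) (Path-cast refl refl (cong star (+-suc j m)) (grow-star j (suc m)))

treeDist-upper : ∀ ts → Path TStep (treeDist (node ts)) (node ts) (star (edgesL ts))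
treeDist-upper ts =
  Path-cast (cong (internalL ts +_) (sym (+-identityʳ (internalL ts)))) refl (cong star edges≡)
    (strip-[] (flatten [] ts []) ++ᴾ grow-star (internalL ts) (leavesL ts))
  where
  edges≡ : internalL ts + leavesL ts ≡ edgesL ts
  edges≡ = trans (+-comm (internalL ts) (leavesL ts)) (sym (edgesL≡leavesL+internalL ts))

treeDist-isDist : ∀ {T n} → edges T ≡ n → IsDist TStep T (star n) (treeDist T)
treeDist-isDist {node ts} refl = isDist (treeDist-upper ts) (treeDist-lower refl)

-- The rotation correspondence: first child becomes left child, next sibling becomes right child.
toBin : List Tree → Bin
toBin []             = tip
toBin (node cs ∷ ts) = bin (toBin cs) (toBin ts)

fromBin : Bin → List Tree
fromBin tip       = []
fromBin (bin l r) = node (fromBin l) ∷ fromBin r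

fromBin-toBin : ∀ ts → fromBin (toBin ts) ≡ ts
fromBin-toBin []             = refl
fromBin-toBin (node cs ∷ ts) = cong₂ (λ cs ts → node cs ∷ ts) (fromBin-toBin cs) (fromBin-toBin ts)

toBin-fromBin : ∀ b → toBin (fromBin b) ≡ b
toBin-fromBin tip       = refl
toBin-fromBin (bin l r) = cong₂ bin (toBin-fromBin l) (toBin-fromBin r)

edgesL-fromBin : ∀ b → edgesL (fromBin b) ≡ size b
edgesL-fromBin tip       = refl
edgesL-fromBin (bin l r) = cong suc (cong₂ _+_ (edgesL-fromBin l) (edgesL-fromBin r))

internalL-fromBin : ∀ b → internalL (fromBin b) ≡ leftEdges b
internalL-fromBin tip               = refl
internalL-fromBin (bin tip r)       = internalL-fromBin r
internalL-fromBin (bin (bin a c) r) = cong₂ (λ x y → suc x + y) (internalL-fromBin (bin a c)) (internalL-fromBin r)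

treeDist-sum : ∀ n {L} → IsEnumeration (λ T → edges T ≡ n) L → sum (map treeDist L) ≡ (n ∸ 1) * length L
treeDist-sum n = sum-via-bins (node ∘ fromBin) fromBin-injective edges-fromBin onto treeDist leftEdges
  (λ b → cong (2 *_) (internalL-fromBin b))
  (λ b → trans (cong (leftEdges b +_) (leftEdges-mirror b)) (leftEdges+rightEdges b))
  where
  fromBin-injective : Injective _≡_ _≡_ (node ∘ fromBin)
  fromBin-injective {b} {b′} eq =
    trans (sym (toBin-fromBin b)) (trans (cong (toBin ∘ children) eq) (toBin-fromBin b′))
  edges-fromBin : ∀ {b} → size b ≡ n → edges (node (fromBin b)) ≡ n
  edges-fromBin {b} = trans (edgesL-fromBin b)
  onto : ∀ {T} → edges T ≡ n → ∃ λ b → size b ≡ n × node (fromBin b) ≡ T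
  onto {node ts} refl =
    toBin ts , trans (sym (edgesL-fromBin (toBin ts))) (cong edgesL (fromBin-toBin ts)) , cong node (fromBin-toBin ts)

descent : ℕ → ℕ → ℕ
descent zero    _       = 0
descent (suc x) zero    = 1
descent (suc x) (suc y) = descent x y

descents : List ℕ → ℕ
descents []          = 0
descents (x ∷ [])    = 0
descents (x ∷ y ∷ w) = descent x y + descents (y ∷ w)

descent-< : ∀ {x y} → y < x → descent x y ≡ 1
descent-< {suc x} {zero}  _         = refl
descent-< {suc x} {suc y} (s≤s y<x) = descent-< y<x

descent-≤ : ∀ {x y} → x ≤ y → descent x y ≡ 0
descent-≤ {zero}          _         = refl
descent-≤ {suc x} {suc y} (s≤s x≤y) = descent-≤ x≤y

descent≤1 : ∀ x y → descent x y ≤ 1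
descent≤1 zero    _       = z≤n
descent≤1 (suc x) zero    = ≤-refl
descent≤1 (suc x) (suc y) = descent≤1 x y

descent-merge : ∀ a x y → descent a x + descent x y ≤ suc (descent a y)
descent-merge zero    x       y       = descent≤1 x y
descent-merge (suc a) zero    y       = s≤s z≤n
descent-merge (suc a) (suc x) zero    = +-monoˡ-≤ 1 (descent≤1 a x)
descent-merge (suc a) (suc x) (suc y) = descent-merge a x y

descent-split : ∀ a x y → descent a y ≤ descent a x + descent x y
descent-split zero    x       y       = z≤n
descent-split (suc a) zero    zero    = ≤-refl
descent-split (suc a) (suc x) zero    = m≤n+m 1 (descent a x)
descent-split (suc a) zero    (suc y) = descent≤1 a y
descent-split (suc a) (suc x) (suc y) = descent-split a x y

descents-delete : ∀ xs x ys → descents (xs ++ x ∷ ys) ≤ suc (descents (xs ++ ys))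
descents-delete []          x []       = z≤n
descents-delete []          x (y ∷ ys) = +-monoˡ-≤ (descents (y ∷ ys)) (descent≤1 x y)
descents-delete (a ∷ [])    x []       = ≤-trans (≤-reflexive (+-identityʳ _)) (descent≤1 a x)
descents-delete (a ∷ [])    x (y ∷ ys) =
  ≤-trans (≤-reflexive (sym (+-assoc (descent a x) _ _))) (+-monoˡ-≤ (descents (y ∷ ys)) (descent-merge a x y))
descents-delete (a ∷ b ∷ xs) x ys =
  ≤-trans (+-monoʳ-≤ (descent a b) (descents-delete (b ∷ xs) x ys)) (≤-reflexive (+-suc (descent a b) _))

descents-insert : ∀ xs x ys → descents (xs ++ ys) ≤ descents (xs ++ x ∷ ys)
descents-insert []           x []       = z≤n
descents-insert []           x (y ∷ ys) = m≤n+m (descents (y ∷ ys)) (descent x y)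
descents-insert (a ∷ [])     x []       = z≤n
descents-insert (a ∷ [])     x (y ∷ ys) =
  ≤-trans (+-monoˡ-≤ (descents (y ∷ ys)) (descent-split a x y)) (≤-reflexive (+-assoc (descent a x) _ _))
descents-insert (a ∷ b ∷ xs) x ys = +-monoʳ-≤ (descent a b) (descents-insert (b ∷ xs) x ys)

descents-++-max : ∀ {m} xs ys → All (_< m) xs → descents (xs ++ m ∷ ys) ≡ descents xs + descents (m ∷ ys)
descents-++-max []           ys _              = refl
descents-++-max (x ∷ [])     ys (x<m ∷ _)      = cong (_+ _) (descent-≤ (<⇒≤ x<m))
descents-++-max (x ∷ y ∷ xs) ys (_ ∷ y∷xs<m)  =
  trans (cong (descent x y +_) (descents-++-max (y ∷ xs) ys y∷xs<m)) (sym (+-assoc (descent x y) _ _))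

descents-max-∷ : ∀ {m} ys → All (_< m) ys → ys ≢ [] → descents (m ∷ ys) ≡ suc (descents ys)
descents-max-∷ []       _          ys≢[] = contradiction refl ys≢[]
descents-max-∷ (y ∷ ys) (y<m ∷ _) _     = cong (_+ _) (descent-< y<m)

StrictlyMonotoneOn : (ℕ → Set) → (ℕ → ℕ) → Set
StrictlyMonotoneOn R f = ∀ {x y} → R x → R y → x < y → f x < f y

module _ {R : ℕ → Set} {f : ℕ → ℕ} (mono : StrictlyMonotoneOn R f) where

  descent-relabel : ∀ {x y} → R x → R y → descent (f x) (f y) ≡ descent x y
  descent-relabel {x} {y} Rx Ry with <-cmp x y
  ... | tri< x<y _ _    = trans (descent-≤ (<⇒≤ (mono Rx Ry x<y))) (sym (descent-≤ (<⇒≤ x<y)))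
  ... | tri≈ _ refl _   = trans (descent-≤ (≤-refl {f x})) (sym (descent-≤ (≤-refl {x})))
  ... | tri> _ _ y<x    = trans (descent-< (mono Ry Rx y<x)) (sym (descent-< y<x))

  descents-relabel : ∀ {w} → All R w → descents (map f w) ≡ descents w
  descents-relabel []                = refl
  descents-relabel (_ ∷ [])          = refl
  descents-relabel (Rx ∷ Ry ∷ Rw) = cong₂ _+_ (descent-relabel Rx Ry) (descents-relabel (Ry ∷ Rw))

  relabel-≢ : ∀ {x y} → R x → R y → x ≢ y → f x ≢ f y
  relabel-≢ {x} {y} Rx Ry x≢y with <-cmp x y
  ... | tri< x<y _ _    = <⇒≢ (mono Rx Ry x<y)
  ... | tri≈ _ x≡y _    = contradiction x≡y x≢y
  ... | tri> _ _ y<x    = >⇒≢ (mono Ry Rx y<x)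

  Unique-relabel : ∀ {w} → All R w → Unique w → Unique (map f w)
  Unique-relabel []        []          = []
  Unique-relabel (Rx ∷ Rw) (x∉w ∷ !w) =
    AllP.map⁺ (All.zipWith (λ (Ry , x≢y) → relabel-≢ Rx Ry x≢y) (Rw , x∉w)) ∷ Unique-relabel Rw !w

descents-shift : ∀ k w → descents (map (k +_) w) ≡ descents w
descents-shift k w = descents-relabel {R = λ _ → ⊤} (λ _ _ → +-monoʳ-< k) (All.universal (λ _ → tt) w)

bumpLetter : ℕ → ℕ → ℕ
bumpLetter a x = if a ≤ᵇ x then suc x else x

unbumpLetter : ℕ → ℕ → ℕ
unbumpLetter x y = if x <ᵇ y then pred y else y

bumpLetter-≥ : ∀ {a x} → a ≤ x → bumpLetter a x ≡ suc x
bumpLetter-≥ {a} {x} a≤x with a ≤ᵇ x | ≤⇒≤ᵇ a≤x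
... | true | _ = refl

bumpLetter-< : ∀ {a x} → x < a → bumpLetter a x ≡ x
bumpLetter-< {a} {x} x<a with a ≤ᵇ x | ≤ᵇ⇒≤ a x
... | true  | a≤x = contradiction (a≤x tt) (<⇒≱ x<a)
... | false | _   = refl

unbumpLetter-> : ∀ {x y} → x < y → unbumpLetter x y ≡ pred y
unbumpLetter-> {x} {y} x<y with x <ᵇ y | <⇒<ᵇ x<y
... | true | _ = refl

unbumpLetter-≤ : ∀ {x y} → y ≤ x → unbumpLetter x y ≡ y
unbumpLetter-≤ {x} {y} y≤x with x <ᵇ y | <ᵇ⇒< x y
... | true  | x<y = contradiction (x<y tt) (≤⇒≯ y≤x)
... | false | _   = refl

bumpLetter-mono : ∀ a → StrictlyMonotoneOn (λ _ → ⊤) (bumpLetter a)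
bumpLetter-mono a {x} {y} _ _ x<y with a ≤? x | a ≤? y
... | yes a≤x | yes a≤y = subst₂ _<_ (sym (bumpLetter-≥ a≤x)) (sym (bumpLetter-≥ a≤y)) (s≤s x<y)
... | yes a≤x | no  a≰y = contradiction (≤-trans a≤x (<⇒≤ x<y)) a≰y
... | no  a≰x | yes a≤y = subst₂ _<_ (sym (bumpLetter-< (≰⇒> a≰x))) (sym (bumpLetter-≥ a≤y)) (m<n⇒m<1+n x<y)
... | no  a≰x | no  a≰y = subst₂ _<_ (sym (bumpLetter-< (≰⇒> a≰x))) (sym (bumpLetter-< (≰⇒> a≰y))) x<y

bumpLetter-≢ : ∀ a y → bumpLetter a y ≢ a
bumpLetter-≢ a y with a ≤? y
... | yes a≤y = subst (_≢ a) (sym (bumpLetter-≥ a≤y)) (>⇒≢ (s≤s a≤y))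
... | no  a≰y = subst (_≢ a) (sym (bumpLetter-< (≰⇒> a≰y))) (<⇒≢ (≰⇒> a≰y))

unbumpLetter-mono : ∀ x → StrictlyMonotoneOn (_≢ x) (unbumpLetter x)
unbumpLetter-mono x {y} {z} y≢x _ y<z with x <? y | x <? z
... | yes x<y | yes x<z = subst₂ _<_ (sym (unbumpLetter-> x<y)) (sym (unbumpLetter-> x<z))
                                    (pred-mono-< ⦃ >-nonZero (m<n⇒0<n x<y) ⦄ y<z)
... | yes x<y | no  x≮z = contradiction (<-trans x<y y<z) x≮z
... | no  x≮y | yes x<z = subst₂ _<_ (sym (unbumpLetter-≤ (≮⇒≥ x≮y))) (sym (unbumpLetter-> x<z))
                                    (≤-trans (≤∧≢⇒< (≮⇒≥ x≮y) y≢x) (<⇒≤pred x<z))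
... | no  x≮y | no  x≮z = subst₂ _<_ (sym (unbumpLetter-≤ (≮⇒≥ x≮y))) (sym (unbumpLetter-≤ (≮⇒≥ x≮z))) y<z

bump-below : ∀ {a} f → All (_< a) f → bump a f ≡ f
bump-below []       []            = refl
bump-below (x ∷ f) (x<a ∷ f<a) = cong₂ _∷_ (bumpLetter-< x<a) (bump-below f f<a)

unbump-below : ∀ {x} w → All (_≤ x) w → unbump x w ≡ w
unbump-below []      []            = refl
unbump-below (y ∷ w) (y≤x ∷ w≤x) = cong₂ _∷_ (unbumpLetter-≤ y≤x) (unbump-below w w≤x)

foldr-⊔-bound : ∀ x xs → x ≤ foldr _⊔_ x xs × All (_≤ foldr _⊔_ x xs) xs
foldr-⊔-bound x []       = ≤-refl , []
foldr-⊔-bound x (y ∷ ys) with x≤ , ys≤ ← foldr-⊔-bound x ys =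
  ≤-trans x≤ (m≤n⊔m y _) , m≤m⊔n y _ ∷ All.map (λ z≤ → ≤-trans z≤ (m≤n⊔m y _)) ys≤

maxL-bound : ∀ f → All (_≤ maxL f) f
maxL-bound []       = []
maxL-bound (x ∷ xs) = foldr-⊔-bound x xs .proj₁ ∷ foldr-⊔-bound x xs .proj₂

bump-above-max : ∀ f → bump (suc (maxL f)) f ≡ f
bump-above-max f = bump-below f (All.map s≤s (maxL-bound f))

PDel-bounded : ∀ u x v → Unique (u ++ x ∷ v) →
  Unique (unbump x u ++ unbump x v) × BoundedStep length descents (u ++ x ∷ v) (unbump x u ++ unbump x v)
PDel-bounded u x v !w with x∉ , !uv ← Unique-extract u !w =
  subst (λ t → Unique t × BoundedStep length descents (u ++ x ∷ v) t) (map-++ (unbumpLetter x) u v)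
    (Unique-relabel mono ≢x !uv , deletion length≡ descents≤)
  where
  mono = unbumpLetter-mono x
  ≢x : All (_≢ x) (u ++ v)
  ≢x = All.map ≢-sym x∉
  length≡ : length (u ++ x ∷ v) ≡ suc (length (map (unbumpLetter x) (u ++ v)))
  length≡ = trans (length-++-∷ u) (cong suc (sym (length-map _ (u ++ v))))
  descents≤ : descents (u ++ x ∷ v) ≤ suc (descents (map (unbumpLetter x) (u ++ v)))
  descents≤ = subst (λ d → descents (u ++ x ∷ v) ≤ suc d) (sym (descents-relabel mono ≢x)) (descents-delete u x v)

-- Every insertion relabels the word by an order embedding avoiding the new letter.
insert-fresh : ∀ {g a} w xs ys → StrictlyMonotoneOn (λ _ → ⊤) g → (∀ y → g y ≢ a) →
  map g w ≡ xs ++ ys → Unique w → Unique (xs ++ a ∷ ys) × BoundedStep length descents w (xs ++ a ∷ ys)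
insert-fresh {g} {a} w xs ys mono fresh gw≡ !w =
  Unique-insert xs a∉ (subst Unique gw≡ (Unique-relabel mono ⊤w !w)) , insertion length≡ descents≤
  where
  ⊤w = All.universal (λ _ → tt) w
  a∉ : All (a ≢_) (xs ++ ys)
  a∉ = subst (All (a ≢_)) gw≡ (AllP.map⁺ (All.universal (λ y → ≢-sym (fresh y)) w))
  length≡ : length (xs ++ a ∷ ys) ≡ suc (length w)
  length≡ = trans (length-++-∷ xs) (cong suc (trans (cong length (sym gw≡)) (length-map g w)))
  descents≤ : descents w ≤ descents (xs ++ a ∷ ys)
  descents≤ = begin
    descents w          ≡⟨ descents-relabel mono ⊤w ⟨
    descents (map g w)  ≡⟨ cong descents gw≡ ⟩
    descents (xs ++ ys) ≤⟨ descents-insert xs a ys ⟩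
    descents (xs ++ a ∷ ys) ∎
    where open ≤-Reasoning

PStep-bounded : ∀ {s t} → Unique s → PStep s t → Unique t × BoundedStep length descents s t
PStep-bounded !s (inj₁ (del u x v))     = PDel-bounded u x v !s
PStep-bounded !s (inj₂ insE)             = [] ∷ [] , insertion refl z≤n
PStep-bounded !s (inj₂ (insA u f v _))   =
  insert-fresh (u ++ f ++ v) (bump a u) (f ++ bump a v) (bumpLetter-mono a) (bumpLetter-≢ a)
    (trans (map-++³ (bumpLetter a) u f v) (cong (λ f′ → bump a u ++ f′ ++ bump a v) (bump-above-max f))) !s
  where a = suc (maxL f)
PStep-bounded !s (inj₂ (insR u f v _))   =
  subst (λ t → Unique t × BoundedStep length descents (u ++ f ++ v) t) (++-assoc (bump a u) f _)
    (insert-fresh (u ++ f ++ v) (bump a u ++ f) (bump a v) (bumpLetter-mono a) (bumpLetter-≢ a) gw≡ !s)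
  where
  a = suc (maxL f)
  gw≡ : map (bumpLetter a) (u ++ f ++ v) ≡ (bump a u ++ f) ++ bump a v
  gw≡ = begin
    map (bumpLetter a) (u ++ f ++ v)  ≡⟨ map-++³ (bumpLetter a) u f v ⟩
    bump a u ++ bump a f ++ bump a v  ≡⟨ cong (λ f′ → bump a u ++ f′ ++ bump a v) (bump-above-max f) ⟩
    bump a u ++ f ++ bump a v         ≡⟨ ++-assoc (bump a u) f _ ⟨
    (bump a u ++ f) ++ bump a v       ∎
    where open ≡-Reasoning
PStep-bounded !s (inj₂ (insL u f v _))   =
  insert-fresh (u ++ f ++ v) (bump a u) (bump a f ++ bump a v) (bumpLetter-mono a) (bumpLetter-≢ a)
    (map-++³ (bumpLetter a) u f v) !s
  where a = minL f

-- One-stack sortable permutations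

-- The decomposition σ = I n J of a one-stack sortable permutation, read as a binary tree.
oss : Bin → List ℕ
oss tip       = []
oss (bin l r) = oss l ++ suc (length (oss l) + length (oss r)) ∷ map (length (oss l) +_) (oss r)

OSS-oss : ∀ b → OSS (oss b)
OSS-oss tip       = empty
OSS-oss (bin l r) = split (OSS-oss l) (OSS-oss r)

parse : ∀ {σ} → OSS σ → Bin
parse empty       = tip
parse (split p q) = bin (parse p) (parse q)

oss-parse : ∀ {σ} (p : OSS σ) → oss (parse p) ≡ σ
oss-parse empty       = refl
oss-parse (split p q) rewrite oss-parse p | oss-parse q = refl

length-oss : ∀ b → length (oss b) ≡ size b
length-oss tip       = refl
length-oss (bin l r) = begin
  length (oss l ++ _ ∷ map _ (oss r))              ≡⟨ length-++-∷ (oss l) ⟩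
  suc (length (oss l ++ map _ (oss r)))            ≡⟨ cong suc (length-++ (oss l)) ⟩
  suc (length (oss l) + length (map _ (oss r)))    ≡⟨ cong (λ n → suc (length (oss l) + n)) (length-map _ (oss r)) ⟩
  suc (length (oss l) + length (oss r))            ≡⟨ cong suc (cong₂ _+_ (length-oss l) (length-oss r)) ⟩
  suc (size l + size r)                            ∎
  where open ≡-Reasoning

top-oss : ∀ l r → suc (length (oss l) + length (oss r)) ≡ size (bin l r)
top-oss l r = cong suc (cong₂ _+_ (length-oss l) (length-oss r))

oss-bounds : ∀ b → All (λ x → 1 ≤ x × x ≤ size b) (oss b)
oss-bounds tip       = []
oss-bounds (bin l r) = AllP.++⁺ (All.map (λ (1≤x , x≤) → 1≤x , ≤-trans x≤ (m≤n⇒m≤1+n (m≤m+n _ _))) (oss-bounds l))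
  ((s≤s z≤n , ≤-reflexive (top-oss l r)) ∷ AllP.map⁺ (All.map shift (oss-bounds r)))
  where
  shift : ∀ {x} → 1 ≤ x × x ≤ size r → 1 ≤ length (oss l) + x × length (oss l) + x ≤ size (bin l r)
  shift {x} (1≤x , x≤) = ≤-trans 1≤x (m≤n+m x _) ,
    ≤-trans (+-mono-≤ (≤-reflexive (length-oss l)) x≤) (n≤1+n _)

module _ (l r : Bin) where
  private
    offset = length (oss l)
    top    = suc (offset + length (oss r))

  left≤ : All (_≤ offset) (oss l)
  left≤ = All.map (λ (_ , x≤) → ≤-trans x≤ (≤-reflexive (sym (length-oss l)))) (oss-bounds l)

  left<top : All (_< top) (oss l)
  left<top = All.map (λ x≤k → s≤s (≤-trans x≤k (m≤m+n offset _))) left≤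

  right> : All (offset <_) (map (offset +_) (oss r))
  right> = AllP.map⁺ (All.map (λ (1≤x , _) → ≤-trans (≤-reflexive (+-comm 1 offset)) (+-monoʳ-≤ offset 1≤x))
                              (oss-bounds r))

  right<top : All (_< top) (map (offset +_) (oss r))
  right<top = AllP.map⁺ (All.map (λ (_ , x≤) → s≤s (+-monoʳ-≤ offset (≤-trans x≤ (≤-reflexive (sym (length-oss r))))))
                                 (oss-bounds r))

Unique-oss : ∀ b → Unique (oss b)
Unique-oss tip       = []
Unique-oss (bin l r) = APP.++⁺ (Unique-oss l)
  (All.map (λ y<top → >⇒≢ y<top) (right<top l r) ∷ Unique.map⁺ (+-cancelˡ-≡ _ _ _) (Unique-oss r))
  (All.map (λ x≤k → All.map (λ k<y → <⇒≢ (≤-<-trans x≤k k<y)) (s≤s (m≤m+n _ _) ∷ right> l r)) (left≤ l r))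

top-≡ : ∀ {l r l′ r′} → oss (bin l r) ≡ oss (bin l′ r′) →
        suc (length (oss l) + length (oss r)) ≡ suc (length (oss l′) + length (oss r′))
top-≡ {l} {r} {l′} {r′} eq = begin
  suc (length (oss l) + length (oss r))    ≡⟨ top-oss l r ⟩
  size (bin l r)                           ≡⟨ length-oss (bin l r) ⟨
  length (oss (bin l r))                   ≡⟨ cong length eq ⟩
  length (oss (bin l′ r′))                 ≡⟨ length-oss (bin l′ r′) ⟩
  size (bin l′ r′)                         ≡⟨ top-oss l′ r′ ⟨
  suc (length (oss l′) + length (oss r′))  ∎
  where open ≡-Reasoning

oss-injective : Injective _≡_ _≡_ oss
oss-injective {tip}     {tip}       _  = refl
oss-injective {tip}     {bin l r}   eq = contradiction (sym eq) (++-∷-≢-[] (oss l))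
oss-injective {bin l r} {tip}       eq = contradiction eq (++-∷-≢-[] (oss l))
oss-injective {bin l r} {bin l′ r′} eq
  with oss-l≡ , right≡ ← split-at-max (oss l) (oss l′) eq
         (subst (λ m → All (_< m) (oss l)) (top-≡ {l} {r} {l′} {r′} eq) (left<top l r))
         (subst (λ m → All (_< m) (oss l′)) (sym (top-≡ {l} {r} {l′} {r′} eq)) (left<top l′ r′))
  with refl ← oss-injective {l} {l′} oss-l≡ =
  cong (bin l) (oss-injective (map-injective (+-cancelˡ-≡ (length (oss l)) _ _) right≡))

shifted-oss-≢-[] : ∀ k a c → map (k +_) (oss (bin a c)) ≢ []
shifted-oss-≢-[] k a c eq = ++-∷-≢-[] (map (k +_) (oss a)) (trans (sym (map-++ (k +_) (oss a) _)) eq)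

descents-top : ∀ {m} k r → All (_< m) (map (k +_) (oss r)) →
               descents (m ∷ map (k +_) (oss r)) ≡ isBin r + descents (oss r)
descents-top k tip       _     = refl
descents-top k (bin a c) r<top =
  trans (descents-max-∷ _ r<top (shifted-oss-≢-[] k a c)) (cong suc (descents-shift k (oss (bin a c))))

descents-oss : ∀ b → descents (oss b) ≡ rightEdges b
descents-oss tip       = refl
descents-oss (bin l r) = begin
  descents (oss l ++ top ∷ right)            ≡⟨ descents-++-max (oss l) right (left<top l r) ⟩
  descents (oss l) + descents (top ∷ right)
    ≡⟨ cong₂ _+_ (descents-oss l) (descents-top (length (oss l)) r (right<top l r)) ⟩
  rightEdges l + (isBin r + descents (oss r)) ≡⟨ cong (λ d → rightEdges l + (isBin r + d)) (descents-oss r) ⟩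
  rightEdges l + (isBin r + rightEdges r)    ≡⟨ +-comm (rightEdges l) _ ⟩
  isBin r + rightEdges r + rightEdges l      ∎
  where
  open ≡-Reasoning
  top   = suc (length (oss l) + length (oss r))
  right = map (length (oss l) +_) (oss r)

rightless : Bin → ℕ
rightless tip                 = 0
rightless (bin l tip)         = suc (rightless l)
rightless (bin l r@(bin _ _)) = rightless l + rightless r

rightEdges+rightless : ∀ b → rightEdges b + rightless b ≡ size b
rightEdges+rightless tip                 = refl
rightEdges+rightless (bin l tip)         = begin
  rightEdges l + suc (rightless l)    ≡⟨ +-suc (rightEdges l) _ ⟩
  suc (rightEdges l + rightless l)    ≡⟨ cong suc (rightEdges+rightless l) ⟩
  suc (size l)                        ≡⟨ cong suc (+-identityʳ (size l)) ⟨
  suc (size l + 0)                    ∎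
  where open ≡-Reasoning
rightEdges+rightless (bin l r@(bin _ _)) = cong suc (begin
  rightEdges r + rightEdges l + (rightless l + rightless r)  ≡⟨ regroup (rightEdges r) (rightEdges l) _ _ ⟩
  (rightEdges l + rightless l) + (rightEdges r + rightless r)
    ≡⟨ cong₂ _+_ (rightEdges+rightless l) (rightEdges+rightless r) ⟩
  size l + size r                                            ∎)
  where
  open ≡-Reasoning
  regroup : ∀ a b c d → a + b + (c + d) ≡ b + c + (a + d)
  regroup = solve-∀

run : ℕ → ℕ → List ℕ
run k zero    = []
run k (suc r) = suc k ∷ run (suc k) r

length-run : ∀ k r → length (run k r) ≡ r
length-run k zero    = refl
length-run k (suc r) = cong suc (length-run (suc k) r)

descents-run : ∀ k r → descents (run k r) ≡ 0
descents-run k zero          = refl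
descents-run k (suc zero)    = refl
descents-run k (suc (suc r)) = cong₂ _+_ (descent-≤ (n≤1+n (suc k))) (descents-run (suc k) (suc r))

applyUpTo-run : ∀ {f} k r → (∀ i → f i ≡ suc (k + i)) → applyUpTo f r ≡ run k r
applyUpTo-run k zero    _  = refl
applyUpTo-run k (suc r) f≡ = cong₂ _∷_ (trans (f≡ 0) (cong suc (+-identityʳ k)))
  (applyUpTo-run (suc k) r (λ i → trans (f≡ (suc i)) (cong suc (+-suc k i))))

identity≡run : ∀ n → identity n ≡ run 0 n
identity≡run n = trans (map-applyUpTo id suc n) (applyUpTo-run 0 n (λ _ → refl))

unbump-run : ∀ {x} k m → x ≤ suc k → unbump x (run (suc k) m) ≡ run k m
unbump-run k zero    _     = refl
unbump-run k (suc m) x≤1+k = cong₂ _∷_ (unbumpLetter-> (s≤s x≤1+k)) (unbump-run (suc k) m (m≤n⇒m≤1+n x≤1+k))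

bump-run : ∀ {a} k r → a ≤ suc k → bump a (run k r) ≡ run (suc k) r
bump-run k zero    _       = refl
bump-run k (suc r) a≤1+k = cong₂ _∷_ (bumpLetter-≥ a≤1+k) (bump-run (suc k) r (m≤n⇒m≤1+n a≤1+k))

delete-max : ∀ u w X m → All (_≤ X) u → All (_≤ X) w →
             PStep (u ++ suc X ∷ w ++ run (suc X) m) (u ++ w ++ run X m)
delete-max u w X m u≤X w≤X = subst (PStep _) result≡ (inj₁ (del u (suc X) (w ++ run (suc X) m)))
  where
  ≤suc : ∀ {v} → All (_≤ X) v → All (_≤ suc X) v
  ≤suc = All.map m≤n⇒m≤1+n
  result≡ : unbump (suc X) u ++ unbump (suc X) (w ++ run (suc X) m) ≡ u ++ w ++ run X m
  result≡ = cong₂ _++_ (unbump-below u (≤suc u≤X))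
    (trans (map-++ (unbumpLetter (suc X)) w _) (cong₂ _++_ (unbump-below w (≤suc w≤X)) (unbump-run X m ≤-refl)))

oss-shift : ∀ k l r → map (k +_) (oss (bin l r)) ≡
            map (k +_) (oss l) ++ suc (k + size l + size r) ∷ map ((k + size l) +_) (oss r)
oss-shift k l r = begin
  map (k +_) (oss l ++ top ∷ map (length (oss l) +_) (oss r))
    ≡⟨ map-++ (k +_) (oss l) _ ⟩
  map (k +_) (oss l) ++ k + top ∷ map (k +_) (map (length (oss l) +_) (oss r))
    ≡⟨ cong₂ (λ t w → map (k +_) (oss l) ++ t ∷ w) top≡ shift≡ ⟩
  map (k +_) (oss l) ++ suc (k + size l + size r) ∷ map ((k + size l) +_) (oss r) ∎
  where
  open ≡-Reasoning
  top = suc (length (oss l) + length (oss r))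
  top≡ : k + top ≡ suc (k + size l + size r)
  top≡ = trans (cong (k +_) (top-oss l r)) (trans (+-suc k _) (cong suc (sym (+-assoc k _ _))))
  shift≡ : map (k +_) (map (length (oss l) +_) (oss r)) ≡ map ((k + size l) +_) (oss r)
  shift≡ = trans (sym (map-∘ (oss r)))
    (map-cong (λ x → trans (sym (+-assoc k _ x)) (cong (λ s → k + s + x) (length-oss l))) (oss r))

shifted-oss-≤ : ∀ k b → All (_≤ k + size b) (map (k +_) (oss b))
shifted-oss-≤ k b = AllP.map⁺ (All.map (λ (_ , x≤) → +-monoʳ-≤ k x≤) (oss-bounds b))

-- The root letter of a node with a right subtree tops a descent and is the largest letter outside
-- the final run; deleting these letters, outermost first, leaves an increasing word.
delete-descents : ∀ b A k m → All (_≤ k) A →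
  Path PStep (rightEdges b) (A ++ map (k +_) (oss b) ++ run (k + size b) m) (A ++ run k (rightless b + m))
delete-descents tip A k m _ = Path-cast refl (cong (λ j → A ++ run j m) (sym (+-identityʳ k))) refl done
delete-descents (bin l tip) A k m A≤k =
  Path-cast refl (sym word≡) (cong (λ j → A ++ run k j) (+-suc (rightless l) m)) (delete-descents l A k (suc m) A≤k)
  where
  word≡ : A ++ map (k +_) (oss (bin l tip)) ++ run (k + size (bin l tip)) m ≡
          A ++ map (k +_) (oss l) ++ run (k + size l) (suc m)
  word≡ = begin
    A ++ map (k +_) (oss (bin l tip)) ++ run (k + suc (size l + 0)) m
      ≡⟨ cong (λ w → A ++ w ++ run (k + suc (size l + 0)) m) (oss-shift k l tip) ⟩
    A ++ (map (k +_) (oss l) ++ suc (k + size l + 0) ∷ []) ++ run (k + suc (size l + 0)) m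
      ≡⟨ cong (A ++_) (++-assoc (map (k +_) (oss l)) _ _) ⟩
    A ++ map (k +_) (oss l) ++ suc (k + size l + 0) ∷ run (k + suc (size l + 0)) m
      ≡⟨ cong₂ (λ t j → A ++ map (k +_) (oss l) ++ t ∷ run j m) (cong suc (+-identityʳ _)) last≡ ⟩
    A ++ map (k +_) (oss l) ++ run (k + size l) (suc m) ∎
    where
    open ≡-Reasoning
    last≡ : k + suc (size l + 0) ≡ suc (k + size l)
    last≡ = trans (+-suc k _) (cong (λ s → suc (k + s)) (+-identityʳ (size l)))
delete-descents (bin l r@(bin _ _)) A k m A≤k =
  Path-cast refl (sym word≡) (cong (λ j → A ++ run k j) (sym (+-assoc (rightless l) _ m)))
    (step (delete-max A′ (map ((k + size l) +_) (oss r)) X m A′≤X (shifted-oss-≤ (k + size l) r))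
      (delete-descents r A′ (k + size l) m A′≤
        ++ᴾ Path-cast refl (sym (++-assoc A _ _)) refl (delete-descents l A k (rightless r + m) A≤k)))
  where
  A′ = A ++ map (k +_) (oss l)
  X  = k + size l + size r
  A′≤ : All (_≤ k + size l) A′
  A′≤ = AllP.++⁺ (All.map (λ x≤k → ≤-trans x≤k (m≤m+n k _)) A≤k) (shifted-oss-≤ k l)
  A′≤X : All (_≤ X) A′
  A′≤X = All.map (λ x≤ → ≤-trans x≤ (m≤m+n _ (size r))) A′≤
  word≡ : A ++ map (k +_) (oss (bin l r)) ++ run (k + size (bin l r)) m ≡
          A′ ++ suc X ∷ map ((k + size l) +_) (oss r) ++ run (suc X) m
  word≡ = begin
    A ++ map (k +_) (oss (bin l r)) ++ run (k + suc (size l + size r)) m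
      ≡⟨ cong₂ (λ w j → A ++ w ++ run j m) (oss-shift k l r) (trans (+-suc k _) (cong suc (sym (+-assoc k _ _)))) ⟩
    A ++ (map (k +_) (oss l) ++ suc X ∷ map ((k + size l) +_) (oss r)) ++ run (suc X) m
      ≡⟨ cong (A ++_) (++-assoc (map (k +_) (oss l)) _ _) ⟩
    A ++ map (k +_) (oss l) ++ suc X ∷ map ((k + size l) +_) (oss r) ++ run (suc X) m
      ≡⟨ ++-assoc A _ _ ⟨
    A′ ++ suc X ∷ map ((k + size l) +_) (oss r) ++ run (suc X) m ∎
    where open ≡-Reasoning

foldr-⊓-run : ∀ k r → foldr _⊓_ 1 (run k r) ≡ 1
foldr-⊓-run k zero    = refl
foldr-⊓-run k (suc r) = trans (cong (suc k ⊓_) (foldr-⊓-run (suc k) r)) (m≥n⇒m⊓n≡n (s≤s z≤n))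

-- Prepend 1 to 1, …, j and renumber, by an insertion of type (Λ →ˡ f) with f the whole word.
extend-run : ∀ j → PStep (run 0 j) (run 0 (suc j))
extend-run zero    = inj₂ insE
extend-run (suc i) = subst₂ PStep (++-identityʳ f) result≡ (inj₂ (insL [] f [] complete))
  where
  f = run 0 (suc i)
  compact : Compact f
  compact = (λ ()) , 1 , ↭-reflexive (trans (sym (identity≡run (suc i))) (cong (range 1) (sym (length-run 0 (suc i)))))
  complete : Complete [] f []
  complete = compact , λ g v′ []≡g++v′ g≢[] _ _ → g≢[] (++-conicalˡ g v′ (sym []≡g++v′))
  result≡ : minL f ∷ bump (minL f) f ++ [] ≡ run 0 (suc (suc i))
  result≡ rewrite foldr-⊓-run 1 i = cong (1 ∷_) (trans (++-identityʳ _) (bump-run 0 (suc i) ≤-refl))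

insert-run : ∀ i j → Path PStep i (run 0 j) (run 0 (i + j))
insert-run zero    j = done
insert-run (suc i) j = step (extend-run j) (Path-cast refl refl (cong (run 0) (+-suc i j)) (insert-run i (suc j)))

descentDist : List ℕ → ℕ
descentDist σ = 2 * descents σ

oss-to-identity : ∀ b → Path PStep (descentDist (oss b)) (oss b) (identity (length (oss b)))
oss-to-identity b =
  Path-cast length≡ start≡ end≡ (delete-descents b [] 0 0 [] ++ᴾ insert-run (rightEdges b) (rightless b + 0))
  where
  length≡ : rightEdges b + rightEdges b ≡ descentDist (oss b)
  length≡ = trans (cong (rightEdges b +_) (sym (+-identityʳ _))) (cong (2 *_) (sym (descents-oss b)))
  start≡ : map (0 +_) (oss b) ++ [] ≡ oss b
  start≡ = trans (++-identityʳ _) (map-id (oss b))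
  end≡ : run 0 (rightEdges b + (rightless b + 0)) ≡ identity (length (oss b))
  end≡ = begin
    run 0 (rightEdges b + (rightless b + 0))  ≡⟨ cong (λ j → run 0 (rightEdges b + j)) (+-identityʳ _) ⟩
    run 0 (rightEdges b + rightless b)        ≡⟨ cong (run 0) (trans (rightEdges+rightless b) (sym (length-oss b))) ⟩
    run 0 (length (oss b))                    ≡⟨ identity≡run _ ⟨
    identity (length (oss b))                 ∎
    where open ≡-Reasoning

descentDist-lower : ∀ {σ k} → Unique σ → Path PStep k σ (identity (length σ)) → descentDist σ ≤ k
descentDist-lower {σ} !σ p = twice-stat≤length p !σ
  (trans (cong descents (identity≡run (length σ))) (descents-run 0 (length σ)))
  (trans (cong length (identity≡run (length σ))) (length-run 0 (length σ)))
  where open LowerBound Unique length descents PStep-bounded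

descentDist-isDist : ∀ {σ n} → OSS σ → length σ ≡ n → IsDist PStep σ (identity n) (descentDist σ)
descentDist-isDist p refl = subst (λ σ → IsDist PStep σ (identity (length σ)) (descentDist σ)) (oss-parse p)
  (isDist (oss-to-identity (parse p)) (descentDist-lower (Unique-oss (parse p))))

descentDist-sum : ∀ n {L} → IsEnumeration (λ σ → OSS σ × length σ ≡ n) L →
                  sum (map descentDist L) ≡ (n ∸ 1) * length L
descentDist-sum n = sum-via-bins oss oss-injective oss-OSS onto descentDist rightEdges
  (λ b → cong (2 *_) (descents-oss b))
  (λ b → trans (cong (rightEdges b +_) (rightEdges-mirror b)) (trans (+-comm (rightEdges b) _) (leftEdges+rightEdges b)))
  where
  oss-OSS : ∀ {b} → size b ≡ n → OSS (oss b) × length (oss b) ≡ n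
  oss-OSS {b} size≡ = OSS-oss b , trans (length-oss b) size≡
  onto : ∀ {σ} → OSS σ × length σ ≡ n → ∃ λ b → size b ≡ n × oss b ≡ σ
  onto (p , length≡) =
    parse p , trans (sym (length-oss (parse p))) (trans (cong length (oss-parse p)) length≡) , oss-parse p

mainTheorem9 : (n : ℕ) → 1 ≤ n →
    (Σ (Tree → ℕ) λ dist →
      (∀ T → edges T ≡ n → IsDist TStep T (star n) (dist T)) ×
      ((L : List Tree) → Unique L → All (λ T → edges T ≡ n) L →
        (∀ T → edges T ≡ n → T ∈ L) →
        sum (map dist L) ≡ (n ∸ 1) * length L))
    ×
    (Σ (List ℕ → ℕ) λ d →
      (∀ σ → OSS σ → length σ ≡ n → IsDist PStep σ (identity n) (d σ)) ×
      ((L : List (List ℕ)) → Unique L → All (λ σ → OSS σ × length σ ≡ n) L →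
        (∀ σ → OSS σ → length σ ≡ n → σ ∈ L) →
        sum (map d L) ≡ (n ∸ 1) * length L))
mainTheorem9 n _ =
  (treeDist ,
    (λ T → treeDist-isDist) ,
    (λ L !L all-n all-L → treeDist-sum n (!L , all-n , all-L))) ,
  (descentDist ,
    (λ σ → descentDist-isDist) ,
    (λ L !L all-n all-L → descentDist-sum n (!L , all-n , λ σ (p , length≡) → all-L σ p length≡)))
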